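{- Let $n>2$ be an integer, let $k$ be an odd integer with $1<k<2^{n}$, and let $r$ be the non-negative integer with $2^r<k<2^{r+1}$. Then $k2^{2n+r}+1\notin\langle\{k2^{n+i}+1\mid i=0,1,\dots,n+r-1\}\rangle$.
   Context: For a set $A$ of non-negative integers, $\langle A\rangle$ denotes the set of all finite linear combinations of elements of $A$ with non-negative integer coefficients. -}

module Defs where

open import Data.Nat using (ℕ; zero; suc; _+_; _*_)
open import Data.Fin using (Fin; toℕ)
open import Data.Product using (∃)
open import Relation.Binary.PropositionalEquality using (_≡_)

sumFin : (m : ℕ) → (Fin m → ℕ) → ℕ
sumFin zero    f = 0
sumFin (suc m) f = f Fin.zero + sumFin m (λ i → f (Fin.suc i))

InSemigroup : (m : ℕ) → (Fin m → ℕ) → ℕ → Set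
InSemigroup m g x = ∃ λ (c : Fin m → ℕ) → sumFin m (λ i → c i * g i) ≡ x

{-# OPTIONS --safe #-}
-- Write A = k 2ⁿ and Q = 2ⁿ⁺ʳ, so the generators are A 2ⁱ + 1 (i < n + r) and the
-- target is A Q + 1, where Q ≤ A because 2ʳ < k. A combination with coefficients cᵢ
-- equals A M + s with M = Σ cᵢ 2ⁱ and s = Σ cᵢ, and s ≤ M, M + s ≤ s Q. If M < Q then
-- comparing with A Q + 1 forces s > A ≥ Q > M ≥ s; if M ≥ Q it forces s = 1, so a single
-- generator is used and M = 2ⁱ < Q.
module Submission where

open import Defs
open import Data.Nat using (ℕ; zero; suc; _+_; _*_; _^_; _<_; _≤_; _<?_; z≤n; s≤s)
open import Data.Nat.Properties
open import Data.Nat.Divisibility using (_∣_)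
open import Data.Nat.Solver using (module +-*-Solver)
open import Data.Fin using (Fin; toℕ)
open import Data.Fin.Properties using (toℕ<n)
open import Data.Product using (_,_)
open import Function using (_∘_)
open import Relation.Nullary using (¬_; yes; no)
open import Relation.Binary.PropositionalEquality

sumFin-cong : ∀ m {f g : Fin m → ℕ} → (∀ i → f i ≡ g i) → sumFin m f ≡ sumFin m g
sumFin-cong zero    f≡g = refl
sumFin-cong (suc m) f≡g = cong₂ _+_ (f≡g Fin.zero) (sumFin-cong m (λ i → f≡g (Fin.suc i)))

sumFin-mono-≤ : ∀ m {f g : Fin m → ℕ} → (∀ i → f i ≤ g i) → sumFin m f ≤ sumFin m g
sumFin-mono-≤ zero    f≤g = z≤n
sumFin-mono-≤ (suc m) f≤g = +-mono-≤ (f≤g Fin.zero) (sumFin-mono-≤ m (λ i → f≤g (Fin.suc i)))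

sumFin-distrib-+ : ∀ m (f g : Fin m → ℕ) →
                   sumFin m (λ i → f i + g i) ≡ sumFin m f + sumFin m g
sumFin-distrib-+ zero    f g = refl
sumFin-distrib-+ (suc m) f g
  rewrite sumFin-distrib-+ m (λ i → f (Fin.suc i)) (λ i → g (Fin.suc i)) =
  +-+-comm (f Fin.zero) (g Fin.zero) _ _
  where
  open +-*-Solver
  +-+-comm : ∀ a b c d → a + b + (c + d) ≡ a + c + (b + d)
  +-+-comm = solve 4 (λ a b c d → a :+ b :+ (c :+ d) := a :+ c :+ (b :+ d)) refl

sumFin-*ˡ : ∀ m (f : Fin m → ℕ) a → sumFin m (λ i → a * f i) ≡ a * sumFin m f
sumFin-*ˡ zero    f a = sym (*-zeroʳ a)
sumFin-*ˡ (suc m) f a rewrite sumFin-*ˡ m (λ i → f (Fin.suc i)) a =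
  sym (*-distribˡ-+ a (f Fin.zero) _)

InSemigroup-cong : ∀ m {g h : Fin m → ℕ} {x y : ℕ} → (∀ i → g i ≡ h i) → x ≡ y →
                   InSemigroup m g x → InSemigroup m h y
InSemigroup-cong m g≡h refl (c , sum≡x) =
  c , trans (sumFin-cong m (λ i → cong (c i *_) (sym (g≡h i)))) sum≡x

module Combination {m : ℕ} (c p : Fin m → ℕ) where

  total : ℕ
  total = sumFin m c

  weighted : ℕ
  weighted = sumFin m (λ i → c i * p i)

  sum-*+1≡ : ∀ A → sumFin m (λ i → c i * (A * p i + 1)) ≡ A * weighted + total
  sum-*+1≡ A = begin
    sumFin m (λ i → c i * (A * p i + 1))       ≡⟨ sumFin-cong m (λ i → distrib (c i) A (p i)) ⟩
    sumFin m (λ i → A * (c i * p i) + c i)     ≡⟨ sumFin-distrib-+ m _ c ⟩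
    sumFin m (λ i → A * (c i * p i)) + total   ≡⟨ cong (_+ total) (sumFin-*ˡ m _ A) ⟩
    A * weighted + total                       ∎
    where
    open ≡-Reasoning
    open +-*-Solver
    distrib : ∀ c a p → c * (a * p + 1) ≡ a * (c * p) + c
    distrib = solve 3 (λ c a p → c :* (a :* p :+ con 1) := a :* (c :* p) :+ c) refl

  total≤weighted : (∀ i → 1 ≤ p i) → total ≤ weighted
  total≤weighted 1≤p = sumFin-mono-≤ m (λ i →
    ≤-trans (≤-reflexive (sym (*-identityʳ (c i)))) (*-monoʳ-≤ (c i) (1≤p i)))

  weighted+total≤total*bound : ∀ Q → (∀ i → p i < Q) → weighted + total ≤ total * Q
  weighted+total≤total*bound Q p<Q = begin
    weighted + total                   ≡⟨ sumFin-distrib-+ m _ c ⟨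
    sumFin m (λ i → c i * p i + c i)   ≤⟨ sumFin-mono-≤ m term≤ ⟩
    sumFin m (λ i → Q * c i)           ≡⟨ sumFin-*ˡ m c Q ⟩
    Q * total                          ≡⟨ *-comm Q total ⟩
    total * Q                          ∎
    where
    open ≤-Reasoning
    term≤ : ∀ i → c i * p i + c i ≤ Q * c i
    term≤ i = begin
      c i * p i + c i     ≡⟨ trans (+-comm _ (c i)) (sym (*-suc (c i) (p i))) ⟩
      c i * suc (p i)     ≤⟨ *-monoʳ-≤ (c i) (p<Q i) ⟩
      c i * Q             ≡⟨ *-comm (c i) Q ⟩
      Q * c i             ∎

A*M+s≢A*Q+1 : ∀ A Q M s → Q ≤ A → s ≤ M → M + s ≤ s * Q → A * M + s ≢ A * Q + 1
A*M+s≢A*Q+1 A Q M zero _ _ M+s≤sQ eq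
  with refl ← n≤0⇒n≡0 (≤-trans (≤-reflexive (sym (+-identityʳ M))) M+s≤sQ)
  = 0≢1+n (trans (cong (_+ 0) (sym (*-zeroʳ A))) (trans eq (+-comm (A * Q) 1)))
A*M+s≢A*Q+1 A Q M (suc s) Q≤A s≤M M+s≤sQ eq with M <? Q
... | yes M<Q = <-irrefl refl (<-≤-trans M<Q (begin
    Q              ≤⟨ Q≤A ⟩
    A              ≤⟨ m≤m+n A 1 ⟩
    A + 1          ≤⟨ A+1≤1+s ⟩
    suc s          ≤⟨ s≤M ⟩
    M              ∎))
  where
  open ≤-Reasoning
  A+1≤1+s : A + 1 ≤ suc s
  A+1≤1+s = +-cancelˡ-≤ (A * M) _ _ (begin
    A * M + (A + 1)    ≡⟨ sym (+-assoc (A * M) A 1) ⟩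
    A * M + A + 1      ≡⟨ cong (_+ 1) (trans (+-comm (A * M) A) (sym (*-suc A M))) ⟩
    A * suc M + 1      ≤⟨ +-monoˡ-≤ 1 (*-monoʳ-≤ A M<Q) ⟩
    A * Q + 1          ≡⟨ sym eq ⟩
    A * M + suc s      ∎)
... | no M≮Q = m+1+n≰m M (begin
    M + suc s      ≤⟨ M+s≤sQ ⟩
    suc s * Q      ≤⟨ *-monoˡ-≤ Q 1+s≤1 ⟩
    1 * Q          ≡⟨ *-identityˡ Q ⟩
    Q              ≤⟨ ≮⇒≥ M≮Q ⟩
    M              ∎)
  where
  open ≤-Reasoning
  1+s≤1 : suc s ≤ 1
  1+s≤1 = +-cancelˡ-≤ (A * Q) _ _ (begin
    A * Q + suc s  ≤⟨ +-monoˡ-≤ (suc s) (*-monoʳ-≤ A (≮⇒≥ M≮Q)) ⟩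
    A * M + suc s  ≡⟨ eq ⟩
    A * Q + 1      ∎)

A*Q+1∉⟨A*p+1⟩ : ∀ m (p : Fin m → ℕ) A Q → Q ≤ A → (∀ i → 1 ≤ p i) → (∀ i → p i < Q) →
                ¬ InSemigroup m (λ i → A * p i + 1) (A * Q + 1)
A*Q+1∉⟨A*p+1⟩ m p A Q Q≤A 1≤p p<Q (c , sum≡) =
  A*M+s≢A*Q+1 A Q weighted total Q≤A (total≤weighted 1≤p) (weighted+total≤total*bound Q p<Q)
    (trans (sym (sum-*+1≡ A)) sum≡)
  where open Combination c p

lemma3 : (n k r : ℕ) → 2 < n → ¬ (2 ∣ k) → 1 < k → k < 2 ^ n →
    2 ^ r < k → k < 2 ^ (r + 1) →
    ¬ InSemigroup (n + r) (λ i → k * 2 ^ (n + toℕ i) + 1) (k * 2 ^ (2 * n + r) + 1)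
lemma3 n k r _ _ _ _ 2^r<k _ =
  A*Q+1∉⟨A*p+1⟩ (n + r) (λ i → 2 ^ toℕ i) (k * 2 ^ n) (2 ^ (n + r)) Q≤A
    (λ i → m^n>0 2 (toℕ i)) (λ i → ^-monoʳ-< 2 (s≤s (s≤s z≤n)) (toℕ<n i))
  ∘ InSemigroup-cong (n + r) (λ i → cong (_+ 1) (k*2^[n+i]≡ (toℕ i))) k*2^[2n+r]+1≡
  where
  open ≡-Reasoning
  k*2^[n+i]≡ : ∀ i → k * 2 ^ (n + i) ≡ k * 2 ^ n * 2 ^ i
  k*2^[n+i]≡ i = trans (cong (k *_) (^-distribˡ-+-* 2 n i)) (sym (*-assoc k (2 ^ n) (2 ^ i)))
  k*2^[2n+r]+1≡ : k * 2 ^ (2 * n + r) + 1 ≡ k * 2 ^ n * 2 ^ (n + r) + 1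
  k*2^[2n+r]+1≡ = cong (_+ 1) (begin
    k * 2 ^ (2 * n + r)     ≡⟨ cong (λ e → k * 2 ^ (e + r)) (cong (n +_) (+-identityʳ n)) ⟩
    k * 2 ^ (n + n + r)     ≡⟨ cong (λ e → k * 2 ^ e) (+-assoc n n r) ⟩
    k * 2 ^ (n + (n + r))   ≡⟨ k*2^[n+i]≡ (n + r) ⟩
    k * 2 ^ n * 2 ^ (n + r) ∎)
  Q≤A : 2 ^ (n + r) ≤ k * 2 ^ n
  Q≤A = ≤-trans (≤-reflexive (trans (^-distribˡ-+-* 2 n r) (*-comm (2 ^ n) (2 ^ r))))
                (*-monoˡ-≤ (2 ^ n) (<⇒≤ 2^r<k))
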